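{- Let $\Gamma$ be a graph whose components are paths, with $\mathfrak{C}(\Gamma)$, $\mathfrak{C}_{\rm even}(\Gamma)$, $\mathfrak{C}_{\rm odd}(\Gamma)$ as below, and let $\mathbb{H}$ be a $\{2,3\}$-hypergraph on $\mathfrak{C}(\Gamma)$ such that each 2-element edge of $\mathbb{H}$ contains one element of $\mathfrak{C}_{\rm even}(\Gamma)$ and one of $\mathfrak{C}_{\rm odd}(\Gamma)$ and each 3-element edge is contained in $\mathfrak{C}_{\rm odd}(\Gamma)$. Suppose $\mathbb{H}$ is connected. Then every nontrivial module $\mathbb{M}$ of $\mathbb{H}$ satisfies $\mathbb{M}\subseteq\mathfrak{C}_{\rm even}(\Gamma)$ or $\mathbb{M}\subseteq\mathfrak{C}_{\rm odd}(\Gamma)$.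
   Context: All structures are finite. For a graph $\Gamma$, $\mathfrak{C}(\Gamma)$ is its set of connected components, and $\mathfrak{C}_{\rm even}(\Gamma)$ (resp. $\mathfrak{C}_{\rm odd}(\Gamma)$) is the set of components with an even (resp. odd) number of vertices. A $\{2,3\}$-hypergraph $\mathbb{H}$ has a vertex set $V(\mathbb{H})$ and an edge set consisting of 2- and 3-element subsets. For a hypergraph $H$, $M\subseteq V(H)$ is a module if for each edge $e$ with $e\cap M\neq\emptyset$, $e\setminus M\neq\emptyset$ there is $m\in M$ with $e\cap M=\{m\}$ and $(e\setminus\{m\})\cup\{n\}\in E(H)$ for all $n\in M$. For a $\{2,3\}$-hypergraph $\mathbb{H}$, $\mathbb{W}\subseteq V(\mathbb{H})$ is a module of $\mathbb{H}$ if it is a module both of $(V(\mathbb{H}),E(\mathbb{H})\cap\binom{V(\mathbb{H})}{2})$ and of $(V(\mathbb{H}),E(\mathbb{H})\cap\binom{V(\mathbb{H})}{3})$; nontrivial means not $\emptyset$, not $V(\mathbb{H})$, not a singleton. $\mathbb{H}$ is connected if the graph on $V(\mathbb{H})$, distinct vertices adjacent iff in a common edge, is connected. -}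

module Defs where

open import Data.Nat using (ℕ; suc)
open import Data.Nat.Divisibility using (_∣_)
open import Data.Fin using (Fin; toℕ)
open import Data.Fin.Subset using (Subset; _∈_; _∉_; _∩_; _∪_; _─_; _-_; ⁅_⁆; ∣_∣; Nonempty; ⊥; ⊤)
open import Data.List using (length; filter)
open import Data.List using (List)
open import Data.Fin.Base using () 
open import Data.Fin.Properties using (_≟_)
open import Data.List.Base using ()
open import Data.Fin.Subset.Properties using ()
open import Data.Product using (Σ; ∃; _×_; _,_)
open import Data.Sum using (_⊎_)
open import Function.Bundles using (_⇔_)
open import Function.Definitions using (Injective; Surjective)
open import Relation.Nullary using (¬_)
open import Relation.Binary.PropositionalEquality using (_≡_; _≢_)
open import Relation.Binary.Construct.Closure.ReflexiveTransitive using (Star)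
import Data.List as L
import Data.Fin as F

record Graph (n : ℕ) : Set₁ where
  field
    Adj   : Fin n → Fin n → Set
    sym   : ∀ {u v} → Adj u v → Adj v u
    irrefl : ∀ {u} → ¬ Adj u u

open Graph public

Reach : ∀ {n} → Graph n → Fin n → Fin n → Set
Reach Γ = Star (Adj Γ)

-- c : Fin n → Fin k enumerates the connected components of Γ:
-- Fin k is identified with 𝔠(Γ), and c v is the component of v.
IsComponentLabelling : ∀ {n k} → Graph n → (Fin n → Fin k) → Set
IsComponentLabelling Γ c =
  (∀ i → ∃ λ v → c v ≡ i) ×
  (∀ u v → (c u ≡ c v) ⇔ Reach Γ u v)

compSize : ∀ {n k} → (Fin n → Fin k) → Fin k → ℕ
compSize {n} c i = length (filter (λ v → c v ≟ i) (L.allFin n))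

EvenComp : ∀ {n k} → (Fin n → Fin k) → Fin k → Set
EvenComp c i = 2 ∣ compSize c i

OddComp : ∀ {n k} → (Fin n → Fin k) → Fin k → Set
OddComp c i = ¬ (2 ∣ compSize c i)

ComponentIsPath : ∀ {n k} → Graph n → (Fin n → Fin k) → Fin k → Set
ComponentIsPath {n} Γ c i =
  Σ ℕ λ m → Σ (Fin (suc m) → Fin n) λ p →
    (∀ a b → p a ≡ p b → a ≡ b) ×
    (∀ v → (c v ≡ i) ⇔ (∃ λ a → p a ≡ v)) ×
    (∀ a b → Adj Γ (p a) (p b) ⇔ ((toℕ b ≡ suc (toℕ a)) ⊎ (toℕ a ≡ suc (toℕ b))))

AllComponentsPaths : ∀ {n k} → Graph n → (Fin n → Fin k) → Set
AllComponentsPaths Γ c = ∀ i → ComponentIsPath Γ c i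

HEdges : ℕ → Set₁
HEdges k = Subset k → Set

Is23 : ∀ {k} → HEdges k → Set
Is23 E = ∀ e → E e → (∣ e ∣ ≡ 2) ⊎ (∣ e ∣ ≡ 3)

edges2 : ∀ {k} → HEdges k → HEdges k
edges2 E e = E e × (∣ e ∣ ≡ 2)

edges3 : ∀ {k} → HEdges k → HEdges k
edges3 E e = E e × (∣ e ∣ ≡ 3)

IsHModule : ∀ {k} → HEdges k → Subset k → Set
IsHModule E M =
  ∀ e → E e → Nonempty (e ∩ M) → Nonempty (e ─ M) →
    ∃ λ m → m ∈ M × (e ∩ M ≡ ⁅ m ⁆) ×
      (∀ x → x ∈ M → E ((e - m) ∪ ⁅ x ⁆))

Is23Module : ∀ {k} → HEdges k → Subset k → Set
Is23Module E M = IsHModule (edges2 E) M × IsHModule (edges3 E) M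

Nontrivial : ∀ {k} → Subset k → Set
Nontrivial M = (M ≢ ⊥) × (M ≢ ⊤) × (¬ ∃ λ v → M ≡ ⁅ v ⁆)

HAdj : ∀ {k} → HEdges k → Fin k → Fin k → Set
HAdj E u v = (u ≢ v) × ∃ λ e → E e × u ∈ e × v ∈ e

HConnected : ∀ {k} → HEdges k → Set
HConnected E = ∀ u v → Star (HAdj E) u v

-- If a module M contained a vertex a of an even component and a vertex b of
-- an odd one, connectivity would give an edge e meeting both M and its
-- complement, and the module property lets every vertex of M replace the
-- unique vertex m of e ∩ M.  A 3-edge would then contain a, which is
-- impossible since 3-edges are odd.  For a 2-edge, replacing m by a forces an
-- odd vertex in e - m and replacing m by b forces an even one, so e would have
-- three distinct vertices.
module Submission where

open import Defs hiding (sym)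
open import Data.Nat using (ℕ; _+_; _≤_; s≤s; z≤n)
open import Data.Nat.Properties using (≤-trans; module ≤-Reasoning)
open import Data.Nat.Divisibility using (_∣?_)
open import Data.Fin using (Fin)
open import Data.Fin.Subset
  using (Subset; _∈_; _∉_; _⊆_; ∣_∣; _∪_; _─_; _-_; ⁅_⁆; ∁; ⊤)
open import Data.Fin.Subset.Properties
  using ( _∈?_; nonempty?; ⊆-antisym; ⊆⊤; x∈∁p⇒x∉p; x∉∁p⇒x∈p; x∈⁅x⁆
        ; x∈⁅y⁆⇒x≡y; x∉⁅y⁆⇒x≢y; x∈p∩q⁺; x∈p∩q⁻; x∈p∪q⁺; x∈p∪q⁻; p─q⊆p
        ; x∈p∧x∉q⇒x∈p─q; x∈p∧x≢y⇒x∈p-y; x∈p⇒∣p-x∣<∣p∣ )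
open import Data.Fin.Properties using (any?)
open import Data.Vec using (_∷_; here; there)
open import Data.Bool using (true; false)
open import Data.Product using (∃; ∃₂; _×_; _,_; proj₁)
open import Data.Sum using (_⊎_; inj₁; inj₂)
open import Data.Empty using (⊥)
open import Relation.Nullary using (¬_; ¬?; yes; no; _×-dec_; contradiction)
open import Relation.Nullary.Decidable using (decidable-stable)
open import Relation.Unary using (Pred; Decidable)
open import Relation.Binary.Core using (Rel)
open import Relation.Binary.PropositionalEquality using (_≡_; _≢_; refl; sym; ≢-sym; subst)
open import Relation.Binary.Construct.Closure.ReflexiveTransitive using (Star; ε; _◅_)

private
  variable
    k : ℕ
    p q : Subset k
    x y z : Fin k

Star-exit : ∀ {a ℓ r} {A : Set a} {R : Rel A ℓ} (P : Pred A r) → Decidable P →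
            ∀ {u w} → Star R u w → P u → ¬ P w →
            ∃₂ λ x y → P x × ¬ P y × R x y
Star-exit P P? ε Pu ¬Pw = contradiction Pu ¬Pw
Star-exit P P? {u} (_◅_ {j = v} Ruv v⋆w) Pu ¬Pw with P? v
... | yes Pv = Star-exit P P? v⋆w Pv ¬Pw
... | no ¬Pv = u , v , Pu , ¬Pv , Ruv

p≢⊤⇒∃∉ : p ≢ ⊤ → ∃ λ w → w ∉ p
p≢⊤⇒∃∉ {p = p} p≢⊤ with nonempty? (∁ p)
... | yes (w , w∈∁p) = w , x∈∁p⇒x∉p w∈∁p
... | no ∁p-empty = contradiction (⊆-antisym ⊆⊤ ⊤⊆p) p≢⊤
  where
    ⊤⊆p : ⊤ ⊆ p
    ⊤⊆p {x} _ = x∉∁p⇒x∈p (λ x∈∁p → ∁p-empty (x , x∈∁p))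

x∈p─q⇒x∉q : x ∈ p ─ q → x ∉ q
x∈p─q⇒x∉q {p = _ ∷ p} {q = true  ∷ q} () here
x∈p─q⇒x∉q {p = _ ∷ p} {q = false ∷ q} here ()
x∈p─q⇒x∉q {p = _ ∷ p} {q = _     ∷ q} (there x∈p─q) (there x∈q) = x∈p─q⇒x∉q x∈p─q x∈q

x∈p-y⇒x≢y : x ∈ p - y → x ≢ y
x∈p-y⇒x≢y x∈p-y = x∉⁅y⁆⇒x≢y (x∈p─q⇒x∉q x∈p-y)

x∈p-y∪⁅z⁆∧x≢z⇒x∈p-y : x ∈ (p - y) ∪ ⁅ z ⁆ → x ≢ z → x ∈ p - y
x∈p-y∪⁅z⁆∧x≢z⇒x∈p-y {p = p} {y} {z} x∈ x≢z with x∈p∪q⁻ (p - y) ⁅ z ⁆ x∈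
... | inj₁ x∈p-y = x∈p-y
... | inj₂ x∈⁅z⁆ = contradiction (x∈⁅y⁆⇒x≡y z x∈⁅z⁆) x≢z

distinct³⇒3≤∣p∣ : x ∈ p → y ∈ p → z ∈ p → x ≢ y → x ≢ z → y ≢ z → 3 ≤ ∣ p ∣
distinct³⇒3≤∣p∣ {x = x} {p} {y} {z} x∈p y∈p z∈p x≢y x≢z y≢z = begin
  3                    ≤⟨ s≤s (s≤s (≤-trans (s≤s z≤n) (x∈p⇒∣p-x∣<∣p∣ z∈p-x-y))) ⟩
  2 + ∣ p - x - y ∣    ≤⟨ s≤s (x∈p⇒∣p-x∣<∣p∣ y∈p-x) ⟩
  1 + ∣ p - x ∣        ≤⟨ x∈p⇒∣p-x∣<∣p∣ x∈p ⟩
  ∣ p ∣                ∎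
  where
    open ≤-Reasoning
    y∈p-x = x∈p∧x≢y⇒x∈p-y y∈p (≢-sym x≢y)
    z∈p-x-y = x∈p∧x≢y⇒x∈p-y (x∈p∧x≢y⇒x∈p-y z∈p (≢-sym x≢z))
                            (≢-sym y≢z)

IsHModule-exchange : ∀ {E : HEdges k} {M e u v} → IsHModule E M →
  E e → u ∈ e → u ∈ M → v ∈ e → v ∉ M →
  ∃ λ m → m ∈ e × ∀ x → x ∈ M → E ((e - m) ∪ ⁅ x ⁆)
IsHModule-exchange {M = M} {e} isModule Ee u∈e u∈M v∈e v∉M
  with isModule e Ee (_ , x∈p∩q⁺ (u∈e , u∈M)) (_ , x∈p∧x∉q⇒x∈p─q v∈e v∉M)
... | m , _ , e∩M≡⁅m⁆ , exchange =
  m , proj₁ (x∈p∩q⁻ e M (subst (m ∈_) (sym e∩M≡⁅m⁆) (x∈⁅x⁆ m))) , exchange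

uniform-or-mixed : ∀ {r} (P : Pred (Fin k) r) → Decidable P → (M : Subset k) →
  (∀ {a b} → a ∈ M → b ∈ M → P a → ¬ P b → ⊥) →
  (∀ x → x ∈ M → P x) ⊎ (∀ x → x ∈ M → ¬ P x)
uniform-or-mixed P P? M unmixed with any? (λ x → x ∈? M ×-dec ¬? (P? x))
... | yes (b , b∈M , ¬Pb) = inj₂ λ a a∈M Pa → unmixed a∈M b∈M Pa ¬Pb
... | no ¬∃ = inj₁ λ x x∈M → decidable-stable (P? x) (λ ¬Px → ¬∃ (x , x∈M , ¬Px))

module _ {k} (E : HEdges k) (Even : Fin k → Set)
  (edge₂-mixed : ∀ e → E e → ∣ e ∣ ≡ 2 →
    ∃₂ λ a b → a ∈ e × b ∈ e × Even a × ¬ Even b)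
  (edge₃-odd : ∀ e → E e → ∣ e ∣ ≡ 3 → ∀ x → x ∈ e → ¬ Even x)
  {M : Subset k}
  where

  parity⇒≢ : Even x → ¬ Even y → x ≢ y
  parity⇒≢ Ex ¬Ey refl = ¬Ey Ex

  crossing-edge₃⇒odd : IsHModule (edges3 E) M → ∀ {e u v} → E e → ∣ e ∣ ≡ 3 →
    u ∈ e → u ∈ M → v ∈ e → v ∉ M → ∀ a → a ∈ M → ¬ Even a
  crossing-edge₃⇒odd isModule Ee ∣e∣≡3 u∈e u∈M v∈e v∉M a a∈M
    with IsHModule-exchange isModule (Ee , ∣e∣≡3) u∈e u∈M v∈e v∉M
  ... | m , _ , exchange with exchange a a∈M
  ... | Ee′ , ∣e′∣≡3 = edge₃-odd _ Ee′ ∣e′∣≡3 a (x∈p∪q⁺ (inj₂ (x∈⁅x⁆ a)))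

  crossing-edge₂⇒unmixed : IsHModule (edges2 E) M → ∀ {e u v} → E e → ∣ e ∣ ≡ 2 →
    u ∈ e → u ∈ M → v ∈ e → v ∉ M →
    ∀ {a b} → a ∈ M → b ∈ M → Even a → ¬ Even b → ⊥
  crossing-edge₂⇒unmixed isModule {e} Ee ∣e∣≡2 u∈e u∈M v∈e v∉M {a} {b} a∈M b∈M Ea ¬Eb
    with IsHModule-exchange isModule (Ee , ∣e∣≡2) u∈e u∈M v∈e v∉M
  ... | m , m∈e , exchange
    with exchange a a∈M | exchange b b∈M
  ... | E[a] , ∣[a]∣≡2 | E[b] , ∣[b]∣≡2
    with edge₂-mixed _ E[a] ∣[a]∣≡2 | edge₂-mixed _ E[b] ∣[b]∣≡2
  ... | _ , odd , _ , odd∈[a] , _ , ¬E-odd | even , _ , even∈[b] , _ , E-even , _ =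
    contradiction (subst (3 ≤_) ∣e∣≡2
      (distinct³⇒3≤∣p∣ m∈e (p─q⊆p e _ odd∈e-m) (p─q⊆p e _ even∈e-m)
        (≢-sym (x∈p-y⇒x≢y odd∈e-m)) (≢-sym (x∈p-y⇒x≢y even∈e-m))
        (≢-sym (parity⇒≢ E-even ¬E-odd))))
      λ { (s≤s (s≤s ())) }
    where
      odd∈e-m : odd ∈ e - m
      odd∈e-m = x∈p-y∪⁅z⁆∧x≢z⇒x∈p-y odd∈[a] (≢-sym (parity⇒≢ Ea ¬E-odd))
      even∈e-m : even ∈ e - m
      even∈e-m = x∈p-y∪⁅z⁆∧x≢z⇒x∈p-y even∈[b] (parity⇒≢ E-even ¬Eb)

  connected-module⇒unmixed : Is23 E → HConnected E → Is23Module E M → M ≢ ⊤ →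
    ∀ {a b} → a ∈ M → b ∈ M → Even a → ¬ Even b → ⊥
  connected-module⇒unmixed is23 connected (module₂ , module₃) M≢⊤ {a} a∈M b∈M Ea ¬Eb
    with p≢⊤⇒∃∉ M≢⊤
  ... | w , w∉M
    with Star-exit (_∈ M) (_∈? M) (connected a w) a∈M w∉M
  ... | u , v , u∈M , v∉M , _ , e , Ee , u∈e , v∈e
    with is23 e Ee
  ... | inj₁ ∣e∣≡2 =
    crossing-edge₂⇒unmixed module₂ Ee ∣e∣≡2 u∈e u∈M v∈e v∉M a∈M b∈M Ea ¬Eb
  ... | inj₂ ∣e∣≡3 = crossing-edge₃⇒odd module₃ Ee ∣e∣≡3 u∈e u∈M v∈e v∉M a a∈M Ea

mainTheorem14 : ∀ {n k} (Γ : Graph n) (c : Fin n → Fin k) →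
    IsComponentLabelling Γ c →
    AllComponentsPaths Γ c →
    (E : HEdges k) → Is23 E →
    (∀ e → E e → ∣ e ∣ ≡ 2 →
      ∃ λ a → ∃ λ b → a ∈ e × b ∈ e × EvenComp c a × OddComp c b) →
    (∀ e → E e → ∣ e ∣ ≡ 3 → ∀ x → x ∈ e → OddComp c x) →
    HConnected E →
    (M : Subset k) → Is23Module E M → Nontrivial M →
    (∀ x → x ∈ M → EvenComp c x) ⊎ (∀ x → x ∈ M → OddComp c x)
mainTheorem14 _ c _ _ E is23 edge₂-mixed edge₃-odd connected M isModule (_ , M≢⊤ , _) =
  uniform-or-mixed (EvenComp c) (λ x → 2 ∣? compSize c x) M
    (connected-module⇒unmixed E (EvenComp c) edge₂-mixed edge₃-odd
      is23 connected isModule M≢⊤)
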